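{- No connected unicyclic graph (connected graph with exactly one cycle) is $(1,2)$-step competition-realizable.
   Context: For vertices $x,y$ of a digraph $H$, $d_H(x,y)$ is the length of a shortest directed $(x,y)$-path. The $(1,2)$-step competition graph $C_{1,2}(D)$ of a digraph $D$ is the simple graph on $V(D)$ in which distinct $u,v$ are adjacent iff there is $w\neq u,v$ with either $d_{D-v}(u,w)\le 1$ and $d_{D-u}(v,w)\le 2$, or $d_{D-u}(v,w)\le 1$ and $d_{D-v}(u,w)\le 2$. A graph is $(1,2)$-step competition-realizable if it is isomorphic to $C_{1,2}(D)$ for some orientation $D$ of a complete bipartite graph $K_{m,n}$ with $m,n\ge1$. -}

module Defs where

open import Level using (0ℓ)
open import Data.Nat using (ℕ; zero; suc; _≥_)
open import Data.Fin using (Fin; zero; suc; inject₁; fromℕ)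
open import Data.Sum using (_⊎_; inj₁; inj₂)
open import Data.Product using (Σ; _×_; _,_; ∃; ∃-syntax)
open import Data.Bool using (Bool; true; false)
open import Data.Empty using (⊥)
open import Relation.Nullary using (¬_)
open import Relation.Binary.PropositionalEquality using (_≡_; _≢_)
open import Relation.Binary.Construct.Closure.ReflexiveTransitive using (Star)
open import Function.Bundles using (_⤖_; _⇔_; Bijection)
open import Function.Definitions using (Injective)

record SimpleGraph (V : Set) : Set₁ where
  field
    Adj    : V → V → Set
    sym    : ∀ {x y} → Adj x y → Adj y x
    irrefl : ∀ {x} → ¬ Adj x x
open SimpleGraph public

Connected : ∀ {V} → SimpleGraph V → Set
Connected {V} G = ∀ (x y : V) → Star (Adj G) x y

record Cycle {V : Set} (G : SimpleGraph V) : Set where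
  field
    j      : ℕ
    vert   : Fin (suc (suc (suc j))) → V
    inj    : Injective _≡_ _≡_ vert
    consec : ∀ (i : Fin (suc (suc j))) → Adj G (vert (inject₁ i)) (vert (suc i))
    close  : Adj G (vert (fromℕ (suc (suc j)))) (vert zero)
open Cycle public

CycleEdge : ∀ {V} {G : SimpleGraph V} → Cycle G → V → V → Set
CycleEdge C x y =
    (∃[ i ] ((x ≡ vert C (inject₁ i) × y ≡ vert C (suc i))
           ⊎ (y ≡ vert C (inject₁ i) × x ≡ vert C (suc i))))
  ⊎ ((x ≡ vert C (fromℕ _) × y ≡ vert C zero)
    ⊎ (y ≡ vert C (fromℕ _) × x ≡ vert C zero))

SameCycle : ∀ {V} {G : SimpleGraph V} → Cycle G → Cycle G → Set
SameCycle C D = ∀ x y → (CycleEdge C x y → CycleEdge D x y) × (CycleEdge D x y → CycleEdge C x y)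

Unicyclic : ∀ {V} → SimpleGraph V → Set
Unicyclic G = Σ (Cycle G) λ C → ∀ (D : Cycle G) → SameCycle C D

ConnectedUnicyclic : ∀ {V} → SimpleGraph V → Set
ConnectedUnicyclic G = Connected G × Unicyclic G

-- Walk≤ A z k u w : there is a directed walk of length ≤ k from u to w in
-- the digraph A all of whose vertices after u avoid z.  For u ≢ z (and
-- w ≢ z) this says exactly  d_{D - z}(u, w) ≤ k.
data Walk≤ {V : Set} (A : V → V → Set) (z : V) : ℕ → V → V → Set where
  here : ∀ {k u} → Walk≤ A z k u u
  step : ∀ {k u x w} → A u x → x ≢ z → Walk≤ A z k x w → Walk≤ A z (suc k) u w

C12Adj : ∀ {V : Set} (A : V → V → Set) → V → V → Set
C12Adj {V} A u v =
  u ≢ v × ∃[ w ] (w ≢ u × w ≢ v ×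
    ((Walk≤ A v 1 u w × Walk≤ A u 2 v w) ⊎ (Walk≤ A u 1 v w × Walk≤ A v 2 u w)))

-- An orientation of K_{m,n} with parts Fin m and Fin n:
-- o a b = true means the arc a → b, false means b → a.
Orientation : ℕ → ℕ → Set
Orientation m n = Fin m → Fin n → Bool

Arc : ∀ {m n} → Orientation m n → Fin m ⊎ Fin n → Fin m ⊎ Fin n → Set
Arc o (inj₁ a) (inj₁ a') = ⊥
Arc o (inj₁ a) (inj₂ b)  = o a b ≡ true
Arc o (inj₂ b) (inj₁ a)  = o a b ≡ false
Arc o (inj₂ b) (inj₂ b') = ⊥

Realizable : ∀ {V : Set} → SimpleGraph V → Set
Realizable {V} G =
  ∃[ m ] ∃[ n ] (m ≥ 1 × n ≥ 1 × Σ (Orientation m n) λ o →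
    Σ (V ⤖ (Fin m ⊎ Fin n)) λ f →
      ∀ x y → Adj G x y ⇔ C12Adj (Arc o) (Bijection.to f x) (Bijection.to f y))

-- Let D orient K_{m,n} and suppose C_{1,2}(D) is connected and unicyclic. Two vertices with a
-- common out-neighbour are adjacent, and a vertex with a neighbour has an out-neighbour, so D has
-- no sink. Then a vertex with three in-neighbours a₁, a₂, a₃ gives, besides the triangle a₁a₂a₃, a
-- second triangle through an in-neighbour of a₁ or a₂, or through the vertex itself when a₁ and a₂
-- are sources; a unicyclic graph has no two such triangles. Up to transposing D, m ≤ n. For m = 1
-- no orientation is sink-free. For K_{2,2} and K_{2,3}, every competition graph has an isolated
-- vertex or a vertex on all edges. Otherwise D contains K_{3,3}, or K_{2,4} when m = 2, and every
-- orientation of these has a sink, which has three in-neighbours in D or (on a side of size two)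
-- is a sink of D, or has two distinct triangles, which persist in D. These three finite facts are
-- checked by evaluation.

module Submission where

open import Defs hiding (sym)
open import Data.Bool using (Bool; true; false; T; not; _∧_; _∨_)
open import Data.Bool.ListAction using (any; all)
open import Data.Bool.Properties using (T-∧; T-∨; ¬-not; not-injective) renaming (_≟_ to _≟ᵇ_)
open import Data.Empty using (⊥; ⊥-elim)
open import Data.Fin using (Fin; zero; suc; _↑ˡ_)
open import Data.Fin.Properties using (any?; ↑ˡ-injective) renaming (_≟_ to _≟ᶠ_)
open import Data.List using (List; []; _∷_; [_]; map; _++_; allFin; cartesianProductWith)
open import Data.List.Membership.Propositional using (_∈_)
open import Data.List.Membership.Propositional.Properties
  using (∈-allFin; ∈-map⁺; ∈-++⁺ˡ; ∈-++⁺ʳ; ∈-cartesianProductWith⁺)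
open import Data.List.Relation.Unary.All using () renaming (lookup to All-lookup)
open import Data.List.Relation.Unary.All.Properties using (all⁺)
open import Data.List.Relation.Unary.Any using (here; there; satisfied)
open import Data.List.Relation.Unary.Any.Properties using (any⁻)
open import Data.Nat using (ℕ; zero; suc; _+_; _≤_; s≤s)
open import Data.Nat.Properties using (≤-total)
open import Data.Product using (∃; ∃-syntax; _×_; _,_; proj₁; proj₂)
open import Data.Sum using (_⊎_; inj₁; inj₂; swap) renaming (map to ⊎-map)
open import Data.Sum.Properties using (≡-dec; inj₁-injective; inj₂-injective; swap-involutive; swap-↔)
open import Data.Unit using (tt)
open import Data.Vec using (Vec; []; _∷_; lookup; tabulate)
open import Data.Vec.Properties using (lookup∘tabulate)
open import Function using (_∘_; id)
open import Function.Bundles using (_⇔_; _↔_; Inverse; Equivalence; mk⇔)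
open import Function.Construct.Identity using (↔-id)
open import Function.Definitions using (Injective)
open import Function.Properties.Bijection using (⤖⇒↔)
open import Relation.Binary.Construct.Closure.ReflexiveTransitive using (ε; _◅_)
open import Relation.Binary.Definitions using (DecidableEquality)
open import Relation.Binary.PropositionalEquality hiding ([_])
open import Relation.Nullary using (¬_; Dec; yes; no)
open import Relation.Nullary.Decidable
  using (⌊_⌋; toWitness; toWitnessFalse; map′; _×-dec_; _⊎-dec_; ¬?)

Triangle : ∀ {V : Set} → (V → V → Set) → V → V → V → Set
Triangle R a b c = R a b × R b c × R a c

record TwoTriangles {V : Set} (R : V → V → Set) : Set where
  field
    a₁ a₂ a₃ b₁ b₂ b₃ : V
    triangleᵃ : Triangle R a₁ a₂ a₃
    triangleᵇ : Triangle R b₁ b₂ b₃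
    a₁≢b₁ : a₁ ≢ b₁
    a₁≢b₂ : a₁ ≢ b₂
    a₁≢b₃ : a₁ ≢ b₃

Isolated : ∀ {V : Set} → (V → V → Set) → V → Set
Isolated R u = ∀ v → ¬ R u v

Centre : ∀ {V : Set} → (V → V → Set) → V → Set
Centre R c = ∀ u v → R u v → u ≡ c ⊎ v ≡ c

record UnicyclicLike {V : Set} (R : V → V → Set) : Set where
  field
    neighbour      : ∀ u → ∃[ v ] R u v
    noCentre       : ∀ c → ¬ Centre R c
    noTwoTriangles : ¬ TwoTriangles R

TwoTriangles-map : ∀ {V W : Set} {R : V → V → Set} {S : W → W → Set} (f : V → W) →
                   Injective _≡_ _≡_ f → (∀ {u v} → R u v → S (f u) (f v)) →
                   TwoTriangles R → TwoTriangles S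
TwoTriangles-map {R = R} {S} f f-inj f-hom t = record
  { a₁ = f a₁ ; a₂ = f a₂ ; a₃ = f a₃ ; b₁ = f b₁ ; b₂ = f b₂ ; b₃ = f b₃
  ; triangleᵃ = triangle triangleᵃ
  ; triangleᵇ = triangle triangleᵇ
  ; a₁≢b₁ = a₁≢b₁ ∘ f-inj
  ; a₁≢b₂ = a₁≢b₂ ∘ f-inj
  ; a₁≢b₃ = a₁≢b₃ ∘ f-inj
  }
  where
  open TwoTriangles t
  triangle : ∀ {a b c} → Triangle R a b c → Triangle S (f a) (f b) (f c)
  triangle (ab , bc , ac) = f-hom ab , f-hom bc , f-hom ac

UnicyclicLike-transport : ∀ {V W : Set} {R : V → V → Set} {S : W → W → Set} (e : V ↔ W) →
                          (∀ x y → R x y ⇔ S (Inverse.to e x) (Inverse.to e y)) →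
                          UnicyclicLike R → UnicyclicLike S
UnicyclicLike-transport {R = R} {S} e R⇔S U = record
  { neighbour      = neighbourˢ
  ; noCentre       = λ c centre → noCentre (from c) (centreᴿ centre)
  ; noTwoTriangles = noTwoTriangles ∘ TwoTriangles-map from from-injective S⇒R
  }
  where
  open Inverse e
  open UnicyclicLike U
  from-injective : Injective _≡_ _≡_ from
  from-injective {x} {y} eq = trans (sym (strictlyInverseˡ x)) (trans (cong to eq) (strictlyInverseˡ y))
  S⇒R : ∀ {u v} → S u v → R (from u) (from v)
  S⇒R {u} {v} s = Equivalence.from (R⇔S (from u) (from v))
                    (subst₂ S (sym (strictlyInverseˡ u)) (sym (strictlyInverseˡ v)) s)
  neighbourˢ : ∀ w → ∃[ v ] S w v
  neighbourˢ w with neighbour (from w)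
  ... | v , r = to v , subst (λ x → S x (to v)) (strictlyInverseˡ w) (Equivalence.to (R⇔S _ v) r)
  centreᴿ : ∀ {c} → Centre S c → Centre R (from c)
  centreᴿ centre u v r = ⊎-map back back (centre (to u) (to v) (Equivalence.to (R⇔S u v) r))
    where
    back : ∀ {x c} → to x ≡ c → x ≡ from c
    back {x} eq = trans (sym (strictlyInverseʳ x)) (cong from eq)

module _ {V : Set} (G : SimpleGraph V) where

  triangle⇒cycle : ∀ {a b c} → Triangle (Adj G) a b c → Cycle G
  triangle⇒cycle {a} {b} {c} (ab , bc , ac) = record
    { j = 0 ; vert = corner ; inj = corner-injective
    ; consec = λ { zero → ab ; (suc zero) → bc }
    ; close = SimpleGraph.sym G ac
    }
    where
    corner : Fin 3 → V
    corner zero = a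
    corner (suc zero) = b
    corner (suc (suc zero)) = c
    adj⇒≢ : ∀ {x y} → Adj G x y → x ≢ y
    adj⇒≢ xy refl = irrefl G xy
    corner-injective : Injective _≡_ _≡_ corner
    corner-injective {zero} {zero} _ = refl
    corner-injective {zero} {suc zero} eq = ⊥-elim (adj⇒≢ ab eq)
    corner-injective {zero} {suc (suc zero)} eq = ⊥-elim (adj⇒≢ ac eq)
    corner-injective {suc zero} {zero} eq = ⊥-elim (adj⇒≢ ab (sym eq))
    corner-injective {suc zero} {suc zero} _ = refl
    corner-injective {suc zero} {suc (suc zero)} eq = ⊥-elim (adj⇒≢ bc eq)
    corner-injective {suc (suc zero)} {zero} eq = ⊥-elim (adj⇒≢ ac (sym eq))
    corner-injective {suc (suc zero)} {suc zero} eq = ⊥-elim (adj⇒≢ bc (sym eq))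
    corner-injective {suc (suc zero)} {suc (suc zero)} _ = refl

  cycleEdge⇒vertex : (C : Cycle G) → ∀ {x y} → CycleEdge C x y → ∃[ k ] x ≡ vert C k
  cycleEdge⇒vertex C (inj₁ (i , inj₁ (x≡ , _))) = _ , x≡
  cycleEdge⇒vertex C (inj₁ (i , inj₂ (_ , x≡))) = _ , x≡
  cycleEdge⇒vertex C (inj₂ (inj₁ (x≡ , _))) = _ , x≡
  cycleEdge⇒vertex C (inj₂ (inj₂ (_ , x≡))) = _ , x≡

  -- The unique cycle has the edge set of every triangle, so an edge a₁a₂ of
  -- the first triangle is an edge of the second one.
  unicyclic⇒¬TwoTriangles : Unicyclic G → ¬ TwoTriangles (Adj G)
  unicyclic⇒¬TwoTriangles (_ , same) t = a₁∉Cᵇ (cycleEdge⇒vertex Cᵇ a₁a₂∈Cᵇ)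
    where
    open TwoTriangles t
    Cᵃ Cᵇ : Cycle G
    Cᵃ = triangle⇒cycle triangleᵃ
    Cᵇ = triangle⇒cycle triangleᵇ
    a₁a₂∈Cᵇ : CycleEdge Cᵇ a₁ a₂
    a₁a₂∈Cᵇ = proj₁ (same Cᵇ a₁ a₂) (proj₂ (same Cᵃ a₁ a₂) a₁a₂∈Cᵃ)
      where
      a₁a₂∈Cᵃ : CycleEdge Cᵃ a₁ a₂
      a₁a₂∈Cᵃ = inj₁ (zero , inj₁ (refl , refl))
    a₁∉Cᵇ : ¬ (∃[ k ] a₁ ≡ vert Cᵇ k)
    a₁∉Cᵇ (zero , eq) = a₁≢b₁ eq
    a₁∉Cᵇ (suc zero , eq) = a₁≢b₂ eq
    a₁∉Cᵇ (suc (suc zero) , eq) = a₁≢b₃ eq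

  cycle-distinct : (C : Cycle G) → ∀ {i k} → i ≢ k → vert C i ≢ vert C k
  cycle-distinct C i≢k = i≢k ∘ inj C

  -- A centre meeting the edges c₀c₁ and c₁c₂ must be c₁, which misses the closing edge.
  cycle⇒¬Centre : Cycle G → ∀ c → ¬ Centre (Adj G) c
  cycle⇒¬Centre C c centre
    with centre _ _ (consec C zero) | centre _ _ (consec C (suc zero)) | centre _ _ (close C)
  ... | inj₁ c₀≡c | inj₁ c₁≡c | _          = cycle-distinct C (λ ()) (trans c₀≡c (sym c₁≡c))
  ... | inj₁ c₀≡c | inj₂ c₂≡c | _          = cycle-distinct C (λ ()) (trans c₀≡c (sym c₂≡c))
  ... | inj₂ c₁≡c | _         | inj₁ cₗ≡c = cycle-distinct C (λ ()) (trans cₗ≡c (sym c₁≡c))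
  ... | inj₂ c₁≡c | _         | inj₂ c₀≡c = cycle-distinct C (λ ()) (trans c₀≡c (sym c₁≡c))

  connected⇒neighbour : Connected G → ∀ {x y} → x ≢ y → ∃[ z ] Adj G x z
  connected⇒neighbour conn {x} {y} x≢y with conn x y
  ... | ε = ⊥-elim (x≢y refl)
  ... | xz ◅ _ = _ , xz

  cycle⇒distinctVertex : DecidableEquality V → Cycle G → ∀ x → ∃[ y ] x ≢ y
  cycle⇒distinctVertex _≟_ C x with x ≟ vert C zero
  ... | yes refl = vert C (suc zero) , cycle-distinct C (λ ())
  ... | no x≢c₀ = vert C zero , x≢c₀

  connectedUnicyclic⇒UnicyclicLike : DecidableEquality V → ConnectedUnicyclic G → UnicyclicLike (Adj G)
  connectedUnicyclic⇒UnicyclicLike _≟_ (conn , uni@(C , _)) = record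
    { neighbour      = λ x → connected⇒neighbour conn (proj₂ (cycle⇒distinctVertex _≟_ C x))
    ; noCentre       = cycle⇒¬Centre C
    ; noTwoTriangles = unicyclic⇒¬TwoTriangles uni
    }

Vertex : ℕ → ℕ → Set
Vertex m n = Fin m ⊎ Fin n

C12 : ∀ {m n} → Orientation m n → Vertex m n → Vertex m n → Set
C12 o = C12Adj (Arc o)

Sink : ∀ {m n} → Orientation m n → Vertex m n → Set
Sink o = Isolated (Arc o)

_≟ᵛ_ : ∀ {m n} → DecidableEquality (Vertex m n)
_≟ᵛ_ = ≡-dec _≟ᶠ_ _≟ᶠ_

∃ᵛ? : ∀ {m n} {P : Vertex m n → Set} → (∀ v → Dec (P v)) → Dec (∃ P)
∃ᵛ? P? = map′ (λ { (inj₁ (i , p)) → inj₁ i , p ; (inj₂ (j , p)) → inj₂ j , p })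
              (λ { (inj₁ i , p) → inj₁ (i , p) ; (inj₂ j , p) → inj₂ (j , p) })
              (any? (P? ∘ inj₁) ⊎-dec any? (P? ∘ inj₂))

module _ {m n : ℕ} (o : Orientation m n) where

  arc? : ∀ u v → Dec (Arc o u v)
  arc? (inj₁ _) (inj₁ _) = no λ ()
  arc? (inj₁ i) (inj₂ j) = o i j ≟ᵇ true
  arc? (inj₂ j) (inj₁ i) = o i j ≟ᵇ false
  arc? (inj₂ _) (inj₂ _) = no λ ()

  arc-irrefl : ∀ {u} → ¬ Arc o u u
  arc-irrefl {inj₁ _} ()
  arc-irrefl {inj₂ _} ()

  arc-asym : ∀ {u v} → Arc o u v → ¬ Arc o v u
  arc-asym {inj₁ _} {inj₂ _} uv vu = true≢false (trans (sym uv) vu)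
    where
    true≢false : true ≢ false
    true≢false ()
  arc-asym {inj₂ j} {inj₁ i} uv vu = arc-asym {inj₁ i} {inj₂ j} vu uv

  arc-2path : ∀ {u v w} → Arc o u v → Arc o v w → ¬ Arc o u w
  arc-2path {inj₁ _} {inj₂ _} {inj₁ _} _ _ ()
  arc-2path {inj₂ _} {inj₁ _} {inj₂ _} _ _ ()

  arc-total : ∀ i j → Arc o (inj₁ i) (inj₂ j) ⊎ Arc o (inj₂ j) (inj₁ i)
  arc-total i j with o i j
  ... | true = inj₁ refl
  ... | false = inj₂ refl

  sink₁⇒inArc : ∀ {i} → Sink o (inj₁ i) → ∀ j → Arc o (inj₂ j) (inj₁ i)
  sink₁⇒inArc sink j = ¬-not (sink (inj₂ j))

  sink₂⇒inArc : ∀ {j} → Sink o (inj₂ j) → ∀ i → Arc o (inj₁ i) (inj₂ j)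
  sink₂⇒inArc sink i = ¬-not (sink (inj₁ i))

  arc-3path : ∀ {x y z w} → Arc o x y → Arc o y z → Arc o z w → Arc o x w ⊎ Arc o w x
  arc-3path {inj₁ i} {inj₂ _} {inj₁ _} {inj₂ j} _ _ _ = arc-total i j
  arc-3path {inj₂ j} {inj₁ _} {inj₂ _} {inj₁ i} _ _ _ = swap (arc-total i j)

  -- u reaches w in one step and v reaches w in at most two steps avoiding u: the first
  -- disjunct of C12Adj with its walks written out.
  CommonPrey : Vertex m n → Vertex m n → Set
  CommonPrey u v = ∃[ w ] (Arc o u w × w ≢ v × (Arc o v w ⊎ ∃[ s ] (Arc o v s × Arc o s w × s ≢ u)))

  commonPrey? : ∀ u v → Dec (CommonPrey u v)
  commonPrey? u v = ∃ᵛ? λ w → arc? u w ×-dec ¬? (w ≟ᵛ v) ×-dec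
                      (arc? v w ⊎-dec ∃ᵛ? λ s → arc? v s ×-dec arc? s w ×-dec ¬? (s ≟ᵛ u))

  arc⇒≢ : ∀ {u v} → Arc o u v → v ≢ u
  arc⇒≢ uv refl = arc-irrefl uv

  commonPrey⇒C12 : ∀ {u v} → u ≢ v → CommonPrey u v → C12 o u v
  commonPrey⇒C12 u≢v (w , uw , w≢v , inj₁ vw) =
    u≢v , w , arc⇒≢ uw , w≢v , inj₁ (step uw w≢v here , step vw (arc⇒≢ uw) here)
  commonPrey⇒C12 u≢v (w , uw , w≢v , inj₂ (s , vs , sw , s≢u)) =
    u≢v , w , arc⇒≢ uw , w≢v , inj₁ (step uw w≢v here , step vs s≢u (step sw (arc⇒≢ uw) here))

  walks⇒commonPrey : ∀ {u v w} → w ≢ u → w ≢ v →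
                     Walk≤ (Arc o) v 1 u w → Walk≤ (Arc o) u 2 v w → CommonPrey u v
  walks⇒commonPrey w≢u _ here _ = ⊥-elim (w≢u refl)
  walks⇒commonPrey _ w≢v (step _ _ here) here = ⊥-elim (w≢v refl)
  walks⇒commonPrey _ w≢v (step uw _ here) (step vw _ here) = _ , uw , w≢v , inj₁ vw
  walks⇒commonPrey _ w≢v (step uw _ here) (step vs s≢u (step sw _ here)) =
    _ , uw , w≢v , inj₂ (_ , vs , sw , s≢u)

  C12⇒commonPrey : ∀ {u v} → C12 o u v → CommonPrey u v ⊎ CommonPrey v u
  C12⇒commonPrey (_ , _ , w≢u , w≢v , inj₁ (near , far)) = inj₁ (walks⇒commonPrey w≢u w≢v near far)
  C12⇒commonPrey (_ , _ , w≢u , w≢v , inj₂ (near , far)) = inj₂ (walks⇒commonPrey w≢v w≢u near far)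

  C12-sym : ∀ {u v} → C12 o u v → C12 o v u
  C12-sym (u≢v , w , w≢u , w≢v , walks) = u≢v ∘ sym , w , w≢v , w≢u , swap walks

  C12? : ∀ u v → Dec (C12 o u v)
  C12? u v = map′ fromPrey (λ uv → proj₁ uv , C12⇒commonPrey uv)
                  (¬? (u ≟ᵛ v) ×-dec (commonPrey? u v ⊎-dec commonPrey? v u))
    where
    fromPrey : u ≢ v × (CommonPrey u v ⊎ CommonPrey v u) → C12 o u v
    fromPrey (u≢v , inj₁ prey) = commonPrey⇒C12 u≢v prey
    fromPrey (u≢v , inj₂ prey) = C12-sym (commonPrey⇒C12 (u≢v ∘ sym) prey)

  C12⇒out : ∀ {u v} → C12 o u v → ∃ (Arc o u)
  C12⇒out uv with C12⇒commonPrey uv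
  ... | inj₁ (w , uw , _) = w , uw
  ... | inj₂ (w , _ , _ , inj₁ uw) = w , uw
  ... | inj₂ (_ , _ , _ , inj₂ (s , us , _)) = s , us

  commonOut⇒C12 : ∀ {u v w} → Arc o u w → Arc o v w → u ≢ v → C12 o u v
  commonOut⇒C12 uw vw u≢v = commonPrey⇒C12 u≢v (_ , uw , arc⇒≢ vw , inj₁ vw)

  twoPath⇒C12 : ∀ {u v s w} → Arc o u w → Arc o v s → Arc o s w → s ≢ u → C12 o u v
  twoPath⇒C12 uw vs sw s≢u =
    commonPrey⇒C12 (λ { refl → arc-2path vs sw uw })
                   (_ , uw , (λ { refl → arc-asym vs sw }) , inj₂ (_ , vs , sw , s≢u))

module _ {V W : Set} {A : V → V → Set} {B : W → W → Set}
         (f : V → W) (f-inj : Injective _≡_ _≡_ f) (f-arc : ∀ {u v} → A u v → B (f u) (f v)) where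

  Walk≤-map : ∀ {z k u w} → Walk≤ A z k u w → Walk≤ B (f z) k (f u) (f w)
  Walk≤-map here = here
  Walk≤-map (step ux x≢z walk) = step (f-arc ux) (x≢z ∘ f-inj) (Walk≤-map walk)

  C12Adj-map : ∀ {u v} → C12Adj A u v → C12Adj B (f u) (f v)
  C12Adj-map (u≢v , w , w≢u , w≢v , walks) =
    u≢v ∘ f-inj , f w , w≢u ∘ f-inj , w≢v ∘ f-inj , ⊎-map walks-map walks-map walks
    where
    walks-map : ∀ {x y k l} → Walk≤ A y k x w × Walk≤ A x l y w →
                Walk≤ B (f y) k (f x) (f w) × Walk≤ B (f x) l (f y) (f w)
    walks-map (near , far) = Walk≤-map near , Walk≤-map far

Arc-cong : ∀ {m n} {o o′ : Orientation m n} → (∀ i j → o i j ≡ o′ i j) →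
           ∀ {u v} → Arc o u v → Arc o′ u v
Arc-cong o≗o′ {inj₁ i} {inj₂ j} uv = trans (sym (o≗o′ i j)) uv
Arc-cong o≗o′ {inj₂ j} {inj₁ i} uv = trans (sym (o≗o′ i j)) uv

C12-cong : ∀ {m n} {o o′ : Orientation m n} → (∀ i j → o i j ≡ o′ i j) →
           ∀ {u v} → C12 o u v → C12 o′ u v
C12-cong o≗o′ = C12Adj-map id id (Arc-cong o≗o′)

UnicyclicLike-cong : ∀ {m n} {o o′ : Orientation m n} → (∀ i j → o i j ≡ o′ i j) →
                     UnicyclicLike (C12 o) → UnicyclicLike (C12 o′)
UnicyclicLike-cong o≗o′ =
  UnicyclicLike-transport (↔-id _) λ _ _ → mk⇔ (C12-cong o≗o′) (C12-cong (λ i j → sym (o≗o′ i j)))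

swap-injective : ∀ {A B : Set} → Injective _≡_ _≡_ (swap {A = A} {B = B})
swap-injective {x = x} {y} eq = trans (sym (swap-involutive x)) (trans (cong swap eq) (swap-involutive y))

transpose : ∀ {m n} → Orientation m n → Orientation n m
transpose o j i = not (o i j)

module _ {m n : ℕ} (o : Orientation m n) where

  arc-transpose : ∀ {u v} → Arc o u v → Arc (transpose o) (swap u) (swap v)
  arc-transpose {inj₁ _} {inj₂ _} uv = cong not uv
  arc-transpose {inj₂ _} {inj₁ _} uv = cong not uv

  arc-untranspose : ∀ {u v} → Arc (transpose o) u v → Arc o (swap u) (swap v)
  arc-untranspose {inj₁ _} {inj₂ _} uv = not-injective uv
  arc-untranspose {inj₂ _} {inj₁ _} uv = not-injective uv

  UnicyclicLike-transpose : UnicyclicLike (C12 o) → UnicyclicLike (C12 (transpose o))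
  UnicyclicLike-transpose = UnicyclicLike-transport swap-↔ λ u v →
    mk⇔ (C12Adj-map swap swap-injective arc-transpose)
        (subst₂ (C12 o) (swap-involutive u) (swap-involutive v)
         ∘ C12Adj-map swap swap-injective arc-untranspose)

restrict : ∀ {m n p q} → Orientation m n → (Fin p → Fin m) → (Fin q → Fin n) → Orientation p q
restrict o ex ey i j = o (ex i) (ey j)

module _ {m n p q : ℕ} (o : Orientation m n) {ex : Fin p → Fin m} {ey : Fin q → Fin n}
         (ex-inj : Injective _≡_ _≡_ ex) (ey-inj : Injective _≡_ _≡_ ey) where

  embed : Vertex p q → Vertex m n
  embed = ⊎-map ex ey

  embed-injective : Injective _≡_ _≡_ embed
  embed-injective {inj₁ _} {inj₁ _} eq = cong inj₁ (ex-inj (inj₁-injective eq))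
  embed-injective {inj₂ _} {inj₂ _} eq = cong inj₂ (ey-inj (inj₂-injective eq))

  TwoTriangles-restrict : TwoTriangles (C12 (restrict o ex ey)) → TwoTriangles (C12 o)
  TwoTriangles-restrict = TwoTriangles-map embed embed-injective (C12Adj-map embed embed-injective arc)
    where
    arc : ∀ {u v} → Arc (restrict o ex ey) u v → Arc o (embed u) (embed v)
    arc {inj₁ _} {inj₂ _} uv = uv
    arc {inj₂ _} {inj₁ _} uv = uv

module _ {m n : ℕ} {o : Orientation m n} {t a₁ a₂ a₃ : Vertex m n}
         (a₁t : Arc o a₁ t) (a₂t : Arc o a₂ t) (a₃t : Arc o a₃ t)
         (a₁≢a₂ : a₁ ≢ a₂) (a₁≢a₃ : a₁ ≢ a₃) (a₂≢a₃ : a₂ ≢ a₃) where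

  inNeighbour⇒TwoTriangles : ∀ {q} → Arc o q a₁ → TwoTriangles (C12 o)
  inNeighbour⇒TwoTriangles {q} qa₁ = record
    { a₁ = q ; a₂ = a₂ ; a₃ = a₃ ; b₁ = a₁ ; b₂ = a₂ ; b₃ = a₃
    ; triangleᵃ = C12-sym o (twoPath⇒C12 o a₂t qa₁ a₁t a₁≢a₂) , a₂a₃ ,
                  C12-sym o (twoPath⇒C12 o a₃t qa₁ a₁t a₁≢a₃)
    ; triangleᵇ = commonOut⇒C12 o a₁t a₂t a₁≢a₂ , a₂a₃ , commonOut⇒C12 o a₁t a₃t a₁≢a₃
    ; a₁≢b₁ = arc⇒≢ o qa₁ ∘ sym
    ; a₁≢b₂ = λ { refl → arc-2path o qa₁ a₁t a₂t }
    ; a₁≢b₃ = λ { refl → arc-2path o qa₁ a₁t a₃t }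
    }
    where
    a₂a₃ = commonOut⇒C12 o a₂t a₃t a₂≢a₃

  -- With a₁ and a₂ sources, a path t → s → t′ gives arcs a₁ → t′ and a₂ → t′,
  -- so t competes with both of them.
  sources⇒TwoTriangles : (∀ q → ¬ Arc o q a₁) → (∀ q → ¬ Arc o q a₂) →
                         ∀ {s t′} → Arc o t s → Arc o s t′ → TwoTriangles (C12 o)
  sources⇒TwoTriangles source₁ source₂ ts st′ = record
    { a₁ = a₃ ; a₂ = a₁ ; a₃ = a₂ ; b₁ = t ; b₂ = a₁ ; b₃ = a₂
    ; triangleᵃ = C12-sym o (commonOut⇒C12 o a₁t a₃t a₁≢a₃) , a₁a₂ ,
                  commonOut⇒C12 o a₃t a₂t (a₂≢a₃ ∘ sym)
    ; triangleᵇ = C12-sym o (competes a₁t source₁) , a₁a₂ , C12-sym o (competes a₂t source₂)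
    ; a₁≢b₁ = arc⇒≢ o a₃t ∘ sym
    ; a₁≢b₂ = a₁≢a₃ ∘ sym
    ; a₁≢b₃ = a₂≢a₃ ∘ sym
    }
    where
    a₁a₂ = commonOut⇒C12 o a₁t a₂t a₁≢a₂
    competes : ∀ {a} → Arc o a t → (∀ q → ¬ Arc o q a) → C12 o a t
    competes {a} at source with arc-3path o at ts st′
    ... | inj₁ at′ = twoPath⇒C12 o at′ ts st′ λ { refl → source t ts }
    ... | inj₂ t′a = ⊥-elim (source _ t′a)

module _ {m n : ℕ} {o : Orientation m n} (U : UnicyclicLike (C12 o)) where
  open UnicyclicLike U

  outNeighbour : ∀ u → ∃ (Arc o u)
  outNeighbour u = C12⇒out o (proj₂ (neighbour u))

  threeInNeighbours⇒⊥ : ∀ {t a₁ a₂ a₃} → Arc o a₁ t → Arc o a₂ t → Arc o a₃ t →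
                        a₁ ≢ a₂ → a₁ ≢ a₃ → a₂ ≢ a₃ → ⊥
  threeInNeighbours⇒⊥ {t} {a₁} {a₂} a₁t a₂t a₃t a₁≢a₂ a₁≢a₃ a₂≢a₃ =
    noTwoTriangles (twoTriangles (∃ᵛ? λ q → arc? o q a₁) (∃ᵛ? λ q → arc? o q a₂))
    where
    twoTriangles : Dec (∃ λ q → Arc o q a₁) → Dec (∃ λ q → Arc o q a₂) → TwoTriangles (C12 o)
    twoTriangles (yes (_ , qa₁)) _ = inNeighbour⇒TwoTriangles a₁t a₂t a₃t a₁≢a₂ a₁≢a₃ a₂≢a₃ qa₁
    twoTriangles (no _) (yes (_ , qa₂)) =
      inNeighbour⇒TwoTriangles a₂t a₁t a₃t (a₁≢a₂ ∘ sym) a₂≢a₃ a₁≢a₃ qa₂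
    twoTriangles (no ¬in₁) (no ¬in₂) =
      sources⇒TwoTriangles a₁t a₂t a₃t a₁≢a₂ a₁≢a₃ a₂≢a₃
        (λ q qa₁ → ¬in₁ (q , qa₁)) (λ q qa₂ → ¬in₂ (q , qa₂))
        (proj₂ (outNeighbour t)) (proj₂ (outNeighbour _))

-- Boolean rather than Dec-valued searches, so that the exhaustive checks below evaluate quickly.
module FiniteSearch {A : Set} (_≟_ : DecidableEquality A) (elems : List A) (complete : ∀ a → a ∈ elems) where

  any-sound : ∀ (p : A → Bool) → T (any p elems) → ∃ (T ∘ p)
  any-sound p = satisfied ∘ any⁻ p elems

  all-sound : ∀ (p : A → Bool) → T (all p elems) → ∀ a → T (p a)
  all-sound p ok a = All-lookup (all⁺ p elems ok) (complete a)

  module _ {R : A → A → Set} (R? : ∀ a b → Dec (R a b)) where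

    isolated? : Bool
    isolated? = any (λ a → all (λ b → not ⌊ R? a b ⌋) elems) elems

    isolated?-sound : T isolated? → ∃ (Isolated R)
    isolated?-sound ok =
      let a , none = any-sound _ ok in a , λ b → toWitnessFalse {a? = R? a b} (all-sound _ none b)

    centre? : Bool
    centre? = any (λ c → all (λ a → all (λ b → not ⌊ R? a b ⌋ ∨ (⌊ a ≟ c ⌋ ∨ ⌊ b ≟ c ⌋))
                                         elems) elems) elems

    centre?-sound : T centre? → ∃ (Centre R)
    centre?-sound ok =
      let c , covered = any-sound _ ok in c , λ a b → edge (all-sound _ (all-sound _ covered a) b)
      where
      edge : ∀ {a b c} → T (not ⌊ R? a b ⌋ ∨ (⌊ a ≟ c ⌋ ∨ ⌊ b ≟ c ⌋)) → R a b → a ≡ c ⊎ b ≡ c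
      edge {a} {b} {c} ok ab with Equivalence.to (T-∨ {not ⌊ R? a b ⌋}) ok
      ... | inj₁ ¬ab = ⊥-elim (toWitnessFalse {a? = R? a b} ¬ab ab)
      ... | inj₂ endpoint =
        ⊎-map (toWitness {a? = a ≟ c}) (toWitness {a? = b ≟ c})
              (Equivalence.to (T-∨ {⌊ a ≟ c ⌋}) endpoint)

    triangle? : (A → A → A → Bool) → Bool
    triangle? k = any (λ a → any (λ b → ⌊ R? a b ⌋ ∧
                    any (λ c → ⌊ R? b c ⌋ ∧ (⌊ R? a c ⌋ ∧ k a b c)) elems) elems) elems

    triangle?-sound : ∀ k → T (triangle? k) → ∃[ a ] ∃[ b ] ∃[ c ] (Triangle R a b c × T (k a b c))
    triangle?-sound k ok =
      let a , okᵃ = any-sound _ ok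
          b , okᵇ = any-sound _ okᵃ
          ab , okᶜ = Equivalence.to (T-∧ {⌊ R? a b ⌋}) okᵇ
          c , abc = any-sound _ okᶜ
          bc , ac∧k = Equivalence.to (T-∧ {⌊ R? b c ⌋}) abc
          ac , k-abc = Equivalence.to (T-∧ {⌊ R? a c ⌋}) ac∧k
      in a , b , c ,
         (toWitness {a? = R? a b} ab , toWitness {a? = R? b c} bc , toWitness {a? = R? a c} ac) , k-abc

    outside : A → A → A → A → A → A → Bool
    outside b₁ b₂ b₃ a₁ _ _ = not ⌊ a₁ ≟ b₁ ⌋ ∧ (not ⌊ a₁ ≟ b₂ ⌋ ∧ not ⌊ a₁ ≟ b₃ ⌋)

    twoTriangles? : Bool
    twoTriangles? = triangle? λ b₁ b₂ b₃ → triangle? (outside b₁ b₂ b₃)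

    twoTriangles?-sound : T twoTriangles? → TwoTriangles R
    twoTriangles?-sound ok =
      let b₁ , b₂ , b₃ , triangleᵇ , okᵃ =
            triangle?-sound (λ b₁ b₂ b₃ → triangle? (outside b₁ b₂ b₃)) ok
          a₁ , a₂ , a₃ , triangleᵃ , a₁∉ᵇ = triangle?-sound (outside b₁ b₂ b₃) okᵃ
          a₁≢b₁ , a₁∉b₂b₃ = Equivalence.to (T-∧ {not ⌊ a₁ ≟ b₁ ⌋}) a₁∉ᵇ
          a₁≢b₂ , a₁≢b₃ = Equivalence.to (T-∧ {not ⌊ a₁ ≟ b₂ ⌋}) a₁∉b₂b₃
      in record
        { a₁ = a₁ ; a₂ = a₂ ; a₃ = a₃ ; b₁ = b₁ ; b₂ = b₂ ; b₃ = b₃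
        ; triangleᵃ = triangleᵃ ; triangleᵇ = triangleᵇ
        ; a₁≢b₁ = toWitnessFalse {a? = a₁ ≟ b₁} a₁≢b₁
        ; a₁≢b₂ = toWitnessFalse {a? = a₁ ≟ b₂} a₁≢b₂
        ; a₁≢b₃ = toWitnessFalse {a? = a₁ ≟ b₃} a₁≢b₃
        }

vertices : ∀ p q → List (Vertex p q)
vertices p q = map inj₁ (allFin p) ++ map inj₂ (allFin q)

∈-vertices : ∀ {p q} (v : Vertex p q) → v ∈ vertices p q
∈-vertices (inj₁ i) = ∈-++⁺ˡ (∈-map⁺ inj₁ (∈-allFin i))
∈-vertices {p} (inj₂ j) = ∈-++⁺ʳ (map inj₁ (allFin p)) (∈-map⁺ inj₂ (∈-allFin j))

module Obstructions {p q : ℕ} (o : Orientation p q) where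
  open FiniteSearch _≟ᵛ_ (vertices p q) ∈-vertices

  LocalObstruction : Set
  LocalObstruction = ∃ (Sink o) ⊎ TwoTriangles (C12 o)

  localObstruction? : Bool
  localObstruction? = isolated? (arc? o) ∨ twoTriangles? (C12? o)

  localObstruction?-sound : T localObstruction? → LocalObstruction
  localObstruction?-sound ok =
    ⊎-map (isolated?-sound (arc? o)) (twoTriangles?-sound (C12? o))
          (Equivalence.to (T-∨ {isolated? (arc? o)}) ok)

  unicyclicObstruction? : Bool
  unicyclicObstruction? = isolated? (C12? o) ∨ centre? (C12? o)

  unicyclicObstruction?-sound : T unicyclicObstruction? → ¬ UnicyclicLike (C12 o)
  unicyclicObstruction?-sound ok U with Equivalence.to (T-∨ {isolated? (C12? o)}) ok
  ... | inj₁ isolated =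
    let u , none = isolated?-sound (C12? o) isolated in none _ (proj₂ (UnicyclicLike.neighbour U u))
  ... | inj₂ centre = let c , covers = centre?-sound (C12? o) centre in UnicyclicLike.noCentre U c covers

Table : ℕ → ℕ → Set
Table p q = Vec (Vec Bool q) p

orientation : ∀ {p q} → Table p q → Orientation p q
orientation t i j = lookup (lookup t i) j

table : ∀ {p q} → Orientation p q → Table p q
table o = tabulate (tabulate ∘ o)

orientation-table : ∀ {p q} (o : Orientation p q) i j → o i j ≡ orientation (table o) i j
orientation-table o i j =
  sym (trans (cong (λ row → lookup row j) (lookup∘tabulate _ i)) (lookup∘tabulate (o i) j))

vectors : ∀ {A : Set} → List A → ∀ k → List (Vec A k)
vectors xs zero = [ [] ]
vectors xs (suc k) = cartesianProductWith _∷_ xs (vectors xs k)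

∈-vectors : ∀ {A : Set} {xs : List A} → (∀ x → x ∈ xs) → ∀ {k} (v : Vec A k) → v ∈ vectors xs k
∈-vectors complete [] = here refl
∈-vectors complete (x ∷ v) = ∈-cartesianProductWith⁺ _∷_ (complete x) (∈-vectors complete v)

tables : ∀ p q → List (Table p q)
tables p q = vectors (vectors (true ∷ false ∷ []) q) p

∈-tables : ∀ {p q} (t : Table p q) → t ∈ tables p q
∈-tables = ∈-vectors (∈-vectors λ { true → here refl ; false → there (here refl) })

table-check-sound : ∀ {p q} (check : Orientation p q → Bool) →
                      T (all (check ∘ orientation) (tables p q)) → ∀ o → T (check (orientation (table o)))
table-check-sound check ok o = All-lookup (all⁺ _ (tables _ _) ok) (∈-tables (table o))

localObstruction-checked : ∀ {p q} → T (all (Obstructions.localObstruction? ∘ orientation) (tables p q)) →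
                   (o : Orientation p q) → Obstructions.LocalObstruction o
localObstruction-checked ok o
  with Obstructions.localObstruction?-sound _ (table-check-sound Obstructions.localObstruction? ok o)
... | inj₁ (v , sink) = inj₁ (v , λ w → sink w ∘ Arc-cong (orientation-table o))
... | inj₂ twoTriangles =
  inj₂ (TwoTriangles-map id id (C12-cong (λ i j → sym (orientation-table o i j))) twoTriangles)

-- By evaluating the check on all 2⁹, resp. 2⁸, orientations.
localObstruction-K₃₃ : (o : Orientation 3 3) → Obstructions.LocalObstruction o
localObstruction-K₃₃ = localObstruction-checked tt

localObstruction-K₂₄ : (o : Orientation 2 4) → Obstructions.LocalObstruction o
localObstruction-K₂₄ = localObstruction-checked tt

¬UnicyclicLike-checked : ∀ {p q} → T (all (Obstructions.unicyclicObstruction? ∘ orientation) (tables p q)) →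
                       (o : Orientation p q) → ¬ UnicyclicLike (C12 o)
¬UnicyclicLike-checked ok o =
  Obstructions.unicyclicObstruction?-sound _ (table-check-sound Obstructions.unicyclicObstruction? ok o)
  ∘ UnicyclicLike-cong (orientation-table o)

¬UnicyclicLike-K₂₂ : (o : Orientation 2 2) → ¬ UnicyclicLike (C12 o)
¬UnicyclicLike-K₂₂ = ¬UnicyclicLike-checked tt

¬UnicyclicLike-K₂₃ : (o : Orientation 2 3) → ¬ UnicyclicLike (C12 o)
¬UnicyclicLike-K₂₃ = ¬UnicyclicLike-checked tt

¬UnicyclicLike-K₁ : ∀ {n} (o : Orientation 1 n) → ¬ UnicyclicLike (C12 o)
¬UnicyclicLike-K₁ o U with outNeighbour U (inj₁ zero)
... | inj₂ j , xy with outNeighbour U (inj₂ j)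
...   | inj₁ zero , yx = arc-asym o {inj₁ zero} {inj₂ j} xy yx

module _ {k : ℕ} {o : Orientation 2 (4 + k)} (U : UnicyclicLike (C12 o)) where
  private
    B = restrict o id (_↑ˡ k)

  localObstruction₂₄⇒⊥ : Obstructions.LocalObstruction B → ⊥
  localObstruction₂₄⇒⊥ (inj₁ (inj₁ i , sink)) =
    threeInNeighbours⇒⊥ U
      {t = inj₁ i} {inj₂ (zero ↑ˡ k)} {inj₂ (suc zero ↑ˡ k)} {inj₂ (suc (suc zero) ↑ˡ k)}
      (in′ zero) (in′ (suc zero)) (in′ (suc (suc zero))) (λ ()) (λ ()) (λ ())
    where in′ = sink₁⇒inArc B sink
  -- A sink of B on the right receives both left vertices, hence is a sink of o.
  localObstruction₂₄⇒⊥ (inj₁ (inj₂ j , sink)) with outNeighbour U (inj₂ (j ↑ˡ k))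
  ... | inj₁ i , yx = arc-asym o {inj₁ i} {inj₂ (j ↑ˡ k)} (sink₂⇒inArc B sink i) yx
  localObstruction₂₄⇒⊥ (inj₂ twoTriangles) =
    UnicyclicLike.noTwoTriangles U (TwoTriangles-restrict o id (↑ˡ-injective k _ _) twoTriangles)

module _ {k l : ℕ} {o : Orientation (3 + k) (3 + l)} (U : UnicyclicLike (C12 o)) where
  private
    B = restrict o (_↑ˡ k) (_↑ˡ l)

  localObstruction₃₃⇒⊥ : Obstructions.LocalObstruction B → ⊥
  localObstruction₃₃⇒⊥ (inj₁ (inj₁ i , sink)) =
    threeInNeighbours⇒⊥ U
      {t = inj₁ (i ↑ˡ k)} {inj₂ (zero ↑ˡ l)} {inj₂ (suc zero ↑ˡ l)} {inj₂ (suc (suc zero) ↑ˡ l)}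
      (in′ zero) (in′ (suc zero)) (in′ (suc (suc zero))) (λ ()) (λ ()) (λ ())
    where in′ = sink₁⇒inArc B sink
  localObstruction₃₃⇒⊥ (inj₁ (inj₂ j , sink)) =
    threeInNeighbours⇒⊥ U
      {t = inj₂ (j ↑ˡ l)} {inj₁ (zero ↑ˡ k)} {inj₁ (suc zero ↑ˡ k)} {inj₁ (suc (suc zero) ↑ˡ k)}
      (in′ zero) (in′ (suc zero)) (in′ (suc (suc zero))) (λ ()) (λ ()) (λ ())
    where in′ = sink₂⇒inArc B sink
  localObstruction₃₃⇒⊥ (inj₂ twoTriangles) =
    UnicyclicLike.noTwoTriangles U
      (TwoTriangles-restrict o (↑ˡ-injective k _ _) (↑ˡ-injective l _ _) twoTriangles)

¬UnicyclicLike-ordered : ∀ {m n} → 1 ≤ m → m ≤ n → (o : Orientation m n) → ¬ UnicyclicLike (C12 o)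
¬UnicyclicLike-ordered {1} _ _ = ¬UnicyclicLike-K₁
¬UnicyclicLike-ordered {2} {2} _ _ = ¬UnicyclicLike-K₂₂
¬UnicyclicLike-ordered {2} {3} _ _ = ¬UnicyclicLike-K₂₃
¬UnicyclicLike-ordered {2} {suc (suc (suc (suc _)))} _ _ _ U =
  localObstruction₂₄⇒⊥ U (localObstruction-K₂₄ _)
¬UnicyclicLike-ordered {suc (suc (suc _))} {suc (suc (suc _))} _ _ _ U =
  localObstruction₃₃⇒⊥ U (localObstruction-K₃₃ _)
¬UnicyclicLike-ordered {2} {1} _ (s≤s ())
¬UnicyclicLike-ordered {suc (suc (suc _))} {2} _ (s≤s (s≤s ()))
¬UnicyclicLike-ordered {suc (suc (suc _))} {1} _ (s≤s ())

¬UnicyclicLike : ∀ {m n} → 1 ≤ m → 1 ≤ n → (o : Orientation m n) → ¬ UnicyclicLike (C12 o)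
¬UnicyclicLike {m} {n} 1≤m 1≤n o with ≤-total m n
... | inj₁ m≤n = ¬UnicyclicLike-ordered 1≤m m≤n o
... | inj₂ n≤m = ¬UnicyclicLike-ordered 1≤n n≤m (transpose o) ∘ UnicyclicLike-transpose o

corollary3p10 : (N : ℕ) (G : SimpleGraph (Fin N)) → ConnectedUnicyclic G → ¬ Realizable G
corollary3p10 N G G-unicyclic (m , n , 1≤m , 1≤n , o , f , G≅C12) =
  ¬UnicyclicLike 1≤m 1≤n o
    (UnicyclicLike-transport (⤖⇒↔ f) G≅C12 (connectedUnicyclic⇒UnicyclicLike G _≟ᶠ_ G-unicyclic))
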